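{- Let $p$ and $q$ be odd primes with $p<q$ such that $q-1$ is not divisible by $p$. Let $u$ and $v$ be the smallest positive integers with $p^u\equiv 1\pmod{q-1}$ and $q^v\equiv 1\pmod{p-1}$. Then for positive integers $a,b$, the number $p^aq^b$ is a weak Carmichael number if and only if $u\mid a$ and $v\mid b$.
   Context: A composite positive integer $n$ is called a weak Carmichael number if $\sum_{1\le k\le n-1,\ \gcd(k,n)=1} k^{n-1}\equiv \varphi(n)\pmod{n}$, where $\varphi$ is Euler's totient function. -}

module Defs where

open import Data.Nat using (ℕ; zero; suc; _+_; _*_; _∸_; _^_; _<_; _≤_)
open import Data.Nat.GCD using (gcd)
open import Data.Nat.Primality using (Composite)
open import Data.Nat.Divisibility using (_∣_)
open import Data.Nat.ListAction using (sum)
open import Data.List using (List; []; _∷_; map; length; filter)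
open import Data.Integer as ℤ using (ℤ; +_)
open import Relation.Binary.PropositionalEquality using (_≡_)
open import Data.Nat using (_≟_)
open import Data.Product using (_×_)

_≡_[mod_] : ℕ → ℕ → ℕ → Set
a ≡ b [mod m ] = m ∣ ℤ.∣ (+ a) ℤ.- (+ b) ∣

range1 : ℕ → List ℕ
range1 zero    = []
range1 (suc n) = range1 n Data.List.++ (suc n ∷ [])

coprimeUnits : ℕ → List ℕ
coprimeUnits n = filter (λ k → gcd k n ≟ 1) (range1 (n ∸ 1))

φ : ℕ → ℕ
φ n = length (filter (λ k → gcd k n ≟ 1) (range1 n))

WeakCarmichael : ℕ → Set
WeakCarmichael n =
  Composite n × (sum (map (λ k → k ^ (n ∸ 1)) (coprimeUnits n)) ≡ φ n [mod n ])

IsLeastPos : (ℕ → Set) → ℕ → Set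
IsLeastPos P u = (0 < u) × P u × (∀ w → 0 < w → P w → u ≤ w)

-- Write E(e, n) = ∑_{k<n, gcd(k,n)=1} (k^e − 1); n is a weak Carmichael number iff n ∣ E(n − 1, n).
--
-- Lifting: for an odd r dividing M, the units below rM are the s + tM (t < r) with s a unit below
-- M, and (s + tM)^e ≡ s^e + e s^(e−1) tM mod rM. Summing over t, and using r ∣ ∑_{t<r} t for odd
-- r, gives E(e, rM) ≡ r E(e, M) mod rM. Iterating, E(e, n) ≡ (n/pq) E(e, pq) mod n for
-- n = p^a q^b, so n ∣ E(e, n) iff pq ∣ E(e, pq).
--
-- Two primes: if p − 1 and q − 1 both divide e, every term of E(e, pq) vanishes mod p and mod q
-- by Fermat. If p − 1 ∤ e then ∑_{r<p} r^e ≡ 0 mod p (by the binomial recurrence for power sums),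
-- and removing the multiples of p and of q gives E(e, pq) ≡ q − 1 mod p; so pq ∣ E(e, pq) would
-- force p ∣ q − 1. Symmetrically q − 1 ∤ e would force q ∣ p − 1, impossible as 0 < p − 1 < q.
--
-- Finally, as p ≡ 1 mod p − 1, p − 1 ∣ n − 1 iff q^b ≡ 1 mod p − 1, i.e. iff v ∣ b; likewise
-- q − 1 ∣ n − 1 iff u ∣ a.

module Submission where

open import Defs

open import Data.Nat as ℕ using (ℕ; zero; suc; z≤n; s≤s; _≤_; _<_; _∸_; _!; _≟_)
import Data.Nat.Properties as ℕₚ
open import Data.Nat.Divisibility
  using ( _∣_; _∣?_; _∣0; divides; ∣-refl; ∣-trans; >⇒∤; ∣1⇒≡1; m∣m*n; n∣m*n; ∣m⇒∣m*n
        ; ∣n⇒∣m*n; ∣m∣n⇒∣m+n; ∣m+n∣m⇒∣n; m%n≡0⇒n∣m)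
open import Data.Nat.DivMod using (_%_; _/_; m/n*n≡m; m≡m%n+[m/n]*n; m%n<n)
open import Data.Nat.GCD using (gcd)
open import Data.Nat.LCM using (lcm; lcm-least; gcd*lcm)
open import Data.Nat.Coprimality using (Coprime; coprime-divisor; coprime⇒gcd≡1; gcd≡1⇒coprime)
  renaming (sym to Coprime-sym)
open import Data.Nat.Primality
  using ( Prime; Composite; composite; euclidsLemma; prime⇒nonZero; prime⇒nonTrivial
        ; prime⇒irreducible; composite⇒nonTrivial)
open import Data.Nat.Combinatorics
  using (_C_; nCn≡1; nC1≡n; nCk≡nC[n∸k]; nCk≡n!/k![n-k]!; k![n∸k]!∣n!)
open import Data.Nat.Induction using (<-rec)
open import Data.Nat.ListAction using (sum)
open import Data.Nat.ListAction.Properties using (sum-++)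
import Data.Nat.Tactic.RingSolver as ℕ-RingSolver

open import Data.Integer as ℤ using (ℤ; 0ℤ; 1ℤ; +_; _+_; _*_; _-_; -_; _^_)
import Data.Integer.Properties as ℤₚ
import Data.Integer.Divisibility.Signed as ℤ∣
open import Data.Integer.Tactic.RingSolver using (solve-∀)

import Algebra.Definitions.RawMonoid ℤ.+-0-rawMonoid as Multiple
import Algebra.Properties.Monoid.Sum ℤₚ.+-0-monoid as FinSum
import Algebra.Properties.Semiring.Exp ℤₚ.+-*-semiring as SemiringExp
import Algebra.Properties.CommutativeSemiring.Exp ℤₚ.+-*-commutativeSemiring as CommutativeSemiringExp
import Algebra.Properties.CommutativeSemiring.Binomial ℤₚ.+-*-commutativeSemiring as Binomial

open import Data.Fin using (toℕ)
open import Data.List using (List; []; _∷_; _++_; map; filter; length)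
open import Data.List.Properties using (filter-++; map-++)
open import Data.Empty using (⊥-elim)
open import Data.Product using (∃; _,_; _×_; proj₁; proj₂; swap)
open import Data.Product.Function.NonDependent.Propositional using (_×-⇔_)
open import Data.Sum using (_⊎_; inj₁; inj₂; [_,_]′)
open import Function.Bundles using (_⇔_; mk⇔; Equivalence)
open import Function.Properties.Equivalence using (⇔-setoid) renaming (trans to ⇔-trans)
open import Level using (0ℓ)
open import Relation.Binary.Bundles using (Setoid)
open import Relation.Binary.Structures using (IsEquivalence)
open import Relation.Binary.PropositionalEquality
  using (_≡_; refl; sym; trans; cong; cong₂; subst; subst₂; module ≡-Reasoning)
open import Relation.Nullary using (¬_; Dec; yes; no; ¬?)
open import Relation.Nullary.Decidable using (decidable-stable)
open import Relation.Unary using (Decidable)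

∑ : ℕ → (ℕ → ℤ) → ℤ
∑ zero    f = 0ℤ
∑ (suc n) f = ∑ n f + f n

syntax ∑ n (λ i → e) = ∑[ i < n ] e

module _ {f g : ℕ → ℤ} where

  ∑-cong : ∀ n → (∀ i → i < n → f i ≡ g i) → ∑ n f ≡ ∑ n g
  ∑-cong zero    f≡g = refl
  ∑-cong (suc n) f≡g =
    cong₂ _+_ (∑-cong n (λ i i<n → f≡g i (ℕₚ.m<n⇒m<1+n i<n))) (f≡g n ℕₚ.≤-refl)

  ∑-distrib-+ : ∀ n → ∑[ i < n ] (f i + g i) ≡ ∑ n f + ∑ n g
  ∑-distrib-+ zero    = refl
  ∑-distrib-+ (suc n) rewrite ∑-distrib-+ n = interchange (∑ n f) (∑ n g) (f n) (g n)
    where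
    interchange : ∀ a b c d → a + b + (c + d) ≡ a + c + (b + d)
    interchange = solve-∀

  ∑-distrib-- : ∀ n → ∑[ i < n ] (f i - g i) ≡ ∑ n f - ∑ n g
  ∑-distrib-- zero    = refl
  ∑-distrib-- (suc n) rewrite ∑-distrib-- n = interchange (∑ n f) (∑ n g) (f n) (g n)
    where
    interchange : ∀ a b c d → a - b + (c - d) ≡ a + c - (b + d)
    interchange = solve-∀

∑-*ˡ : ∀ n c (f : ℕ → ℤ) → ∑[ i < n ] (c * f i) ≡ c * ∑ n f
∑-*ˡ zero    c f = sym (ℤₚ.*-zeroʳ c)
∑-*ˡ (suc n) c f rewrite ∑-*ˡ n c f = sym (ℤₚ.*-distribˡ-+ c (∑ n f) (f n))

∑-const : ∀ n c → ∑[ _ < n ] c ≡ + n * c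
∑-const zero    c = sym (ℤₚ.*-zeroˡ c)
∑-const (suc n) c rewrite ∑-const n c = step (+ n) c
  where
  step : ∀ a c → a * c + c ≡ (1ℤ + a) * c
  step = solve-∀

∑-zero : ∀ n (f : ℕ → ℤ) → (∀ i → i < n → f i ≡ 0ℤ) → ∑ n f ≡ 0ℤ
∑-zero n f f≡0 = trans (∑-cong n f≡0) (trans (∑-const n 0ℤ) (ℤₚ.*-zeroʳ (+ n)))

∑-split : ∀ m n (f : ℕ → ℤ) → ∑ (m ℕ.+ n) f ≡ ∑ m f + ∑[ i < n ] f (m ℕ.+ i)
∑-split m zero    f rewrite ℕₚ.+-identityʳ m = sym (ℤₚ.+-identityʳ (∑ m f))
∑-split m (suc n) f rewrite ℕₚ.+-suc m n | ∑-split m n f =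
  ℤₚ.+-assoc (∑ m f) _ (f (m ℕ.+ n))

∑-suc : ∀ n (f : ℕ → ℤ) → ∑ (suc n) f ≡ f 0 + ∑[ i < n ] f (suc i)
∑-suc n f = trans (∑-split 1 n f) (cong (_+ ∑[ i < n ] f (suc i)) (ℤₚ.+-identityˡ (f 0)))

∑-blocks : ∀ M j (f : ℕ → ℤ) → ∑ (j ℕ.* M) f ≡ ∑[ t < j ] ∑[ r < M ] f (r ℕ.+ t ℕ.* M)
∑-blocks M zero    f = refl
∑-blocks M (suc j) f = begin
  ∑ (M ℕ.+ j ℕ.* M) f
    ≡⟨ cong (λ x → ∑ x f) (ℕₚ.+-comm M (j ℕ.* M)) ⟩
  ∑ (j ℕ.* M ℕ.+ M) f
    ≡⟨ ∑-split (j ℕ.* M) M f ⟩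
  ∑ (j ℕ.* M) f + ∑[ r < M ] f (j ℕ.* M ℕ.+ r)
    ≡⟨ cong₂ _+_ (∑-blocks M j f) (∑-cong M (λ r _ → cong f (ℕₚ.+-comm (j ℕ.* M) r))) ⟩
  ∑[ t < j ] ∑[ r < M ] f (r ℕ.+ t ℕ.* M) + ∑[ r < M ] f (r ℕ.+ j ℕ.* M)
    ∎
  where open ≡-Reasoning

∑-comm : ∀ n m (f : ℕ → ℕ → ℤ) → ∑[ i < n ] ∑[ j < m ] f i j ≡ ∑[ j < m ] ∑[ i < n ] f i j
∑-comm zero    m f = sym (∑-zero m _ (λ _ _ → refl))
∑-comm (suc n) m f rewrite ∑-comm n m f =
  sym (∑-distrib-+ {λ j → ∑[ i < n ] f i j} {λ j → f n j} m)

∑-telescope : ∀ n (f : ℕ → ℤ) → ∑[ r < n ] (f (suc r) - f r) ≡ f n - f 0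
∑-telescope zero    f = sym (ℤₚ.+-inverseʳ (f 0))
∑-telescope (suc n) f rewrite ∑-telescope n f = collapse (f (suc n)) (f n) (f 0)
  where
  collapse : ∀ a b c → b - c + (a - b) ≡ a - c
  collapse = solve-∀

prime>0 : ∀ {p} → Prime p → 0 < p
prime>0 {p} pp = ℕ.>-nonZero⁻¹ p {{prime⇒nonZero pp}}

prime∣⇒¬coprime : ∀ {p a b} → Prime p → p ∣ a → p ∣ b → ¬ Coprime a b
prime∣⇒¬coprime pp p∣a p∣b a⊥b = ℕ.nonTrivial⇒≢1 {{prime⇒nonTrivial pp}} (a⊥b (p∣a , p∣b))

∤⇒coprime : ∀ {p k} → Prime p → ¬ p ∣ k → Coprime k p
∤⇒coprime pp p∤k (i∣k , i∣p) with prime⇒irreducible pp i∣p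
... | inj₁ i≡1 = i≡1
... | inj₂ refl = ⊥-elim (p∤k i∣k)

coprime-* : ∀ {x a b} → Coprime x a → Coprime x b → Coprime x (a ℕ.* b)
coprime-* {x} {a} x⊥a x⊥b {i} (i∣x , i∣ab) = x⊥b (i∣x , coprime-divisor i⊥a i∣ab)
  where
  i⊥a : Coprime i a
  i⊥a (d∣i , d∣a) = x⊥a (∣-trans d∣i i∣x , d∣a)

coprime⇒*∣ : ∀ {m n c} → Coprime m n → m ∣ c → n ∣ c → m ℕ.* n ∣ c
coprime⇒*∣ {m} {n} m⊥n m∣c n∣c = subst (_∣ _) lcm≡m*n (lcm-least m∣c n∣c)
  where
  lcm≡m*n : lcm m n ≡ m ℕ.* n
  lcm≡m*n = trans (sym (ℕₚ.*-identityˡ (lcm m n)))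
                  (trans (cong (ℕ._* lcm m n) (sym (coprime⇒gcd≡1 m⊥n))) (gcd*lcm m n))

module _ {s M : ℕ} (t : ℕ) where

  private
    s+tM = s ℕ.+ t ℕ.* M

  ∣s+tM⇒∣s : ∀ {i} → i ∣ M → i ∣ s+tM → i ∣ s
  ∣s+tM⇒∣s {i} i∣M i∣s+tM =
    ∣m+n∣m⇒∣n (subst (i ∣_) (ℕₚ.+-comm s (t ℕ.* M)) i∣s+tM) (∣n⇒∣m*n t i∣M)

  coprime-shift⇒ : ∀ r → Coprime s+tM (r ℕ.* M) → Coprime s M
  coprime-shift⇒ r s+tM⊥rM (i∣s , i∣M) = s+tM⊥rM (∣m∣n⇒∣m+n i∣s (∣n⇒∣m*n t i∣M) , ∣n⇒∣m*n r i∣M)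

  coprime-shift⇐ : ∀ {r} → r ∣ M → Coprime s M → Coprime s+tM (r ℕ.* M)
  coprime-shift⇐ r∣M s⊥M = coprime-* (λ (i∣x , i∣r) → s+tM⊥M (i∣x , ∣-trans i∣r r∣M)) s+tM⊥M
    where
    s+tM⊥M : Coprime s+tM M
    s+tM⊥M (i∣x , i∣M) = s⊥M (∣s+tM⇒∣s i∣M i∣x , i∣M)

multiple-not-unit : ∀ {n k} → 1 < n → n ∣ k → ¬ gcd k n ≡ 1
multiple-not-unit 1<n n∣k gcd≡1 = ℕₚ.<⇒≢ 1<n (sym (gcd≡1⇒coprime gcd≡1 (n∣k , ∣-refl)))

prime*-composite : ∀ {p m} → Prime p → 1 < m → Composite (p ℕ.* m)
prime*-composite {p} {m} pp 1<m = composite (ℕₚ.m<m*n p m 1<m) (m∣m*n m)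
  where instance
    _ = prime⇒nonTrivial pp
    _ = prime⇒nonZero pp

^*^-composite : ∀ {p q} → Prime p → Prime q → ∀ i j → Composite (p ℕ.^ suc i ℕ.* q ℕ.^ suc j)
^*^-composite {p} {q} pp pq i j =
  subst Composite (sym (ℕₚ.*-assoc p (p ℕ.^ i) (q ℕ.^ suc j))) (prime*-composite pp (begin-strict
    1                           <⟨ ℕ.nonTrivial⇒n>1 q {{prime⇒nonTrivial pq}} ⟩
    q                           ≤⟨ ℕₚ.m≤m*n q (q ℕ.^ j) {{ℕₚ.m^n≢0 q j}} ⟩
    q ℕ.^ suc j                 ≤⟨ ℕₚ.m≤n*m (q ℕ.^ suc j) (p ℕ.^ i) {{ℕₚ.m^n≢0 p i}} ⟩
    p ℕ.^ i ℕ.* q ℕ.^ suc j     ∎))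
  where
  open ℕₚ.≤-Reasoning
  instance
    _ = prime⇒nonZero pp
    _ = prime⇒nonZero pq

odd⇒≡1+2h : ∀ r → ¬ 2 ∣ r → ∃ λ h → r ≡ suc (h ℕ.* 2)
odd⇒≡1+2h zero          2∤0 = ⊥-elim (2∤0 (divides 0 refl))
odd⇒≡1+2h (suc zero)    _   = 0 , refl
odd⇒≡1+2h (suc (suc r)) 2∤r with odd⇒≡1+2h r (λ 2∣r → 2∤r (∣m∣n⇒∣m+n (∣-refl {2}) 2∣r))
... | h , refl = suc h , refl

prime∤! : ∀ {p} → Prime p → ∀ m → m < p → ¬ p ∣ m !
prime∤! pp zero    _   p∣1 = ℕ.nonTrivial⇒≢1 {{prime⇒nonTrivial pp}} (∣1⇒≡1 p∣1)
prime∤! pp (suc m) m<p p∣m! = [ >⇒∤ m<p , prime∤! pp m (ℕₚ.<-trans (ℕₚ.n<1+n m) m<p) ]′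
  (euclidsLemma (suc m) (m !) pp p∣m!)

nCk*k!*[n∸k]!≡n! : ∀ {n k} → k ≤ n → (n C k) ℕ.* (k ! ℕ.* (n ∸ k) !) ≡ n !
nCk*k!*[n∸k]!≡n! {n} {k} k≤n =
  trans (cong (ℕ._* (k ! ℕ.* (n ∸ k) !)) (nCk≡n!/k![n-k]! k≤n)) (m/n*n≡m (k![n∸k]!∣n! k≤n))
  where instance _ = k ℕₚ.!* (n ∸ k) !≢0

prime∣pCk : ∀ {p k} → Prime p → 0 < k → k < p → p ∣ p C k
prime∣pCk {p@(suc m)} {k} pp 0<k k<p
  with euclidsLemma (p C k) (k ! ℕ.* (p ∸ k) !) pp
         (subst (p ∣_) (sym (nCk*k!*[n∸k]!≡n! (ℕₚ.<⇒≤ k<p))) (m∣m*n (m !)))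
... | inj₁ p∣pCk = p∣pCk
... | inj₂ p∣k![p∸k]! = ⊥-elim ([ prime∤! pp k k<p , prime∤! pp (p ∸ k) p∸k<p ]′
  (euclidsLemma (k !) ((p ∸ k) !) pp p∣k![p∸k]!))
  where p∸k<p = ℕₚ.∸-monoʳ-< 0<k (ℕₚ.<⇒≤ k<p)

infix 4 _≈_[mod_]

-- A record rather than m ∣ a − b itself, so that a and b can be inferred from a proof.
record _≈_[mod_] (a b m : ℤ) : Set where
  constructor mod∣
  field
    m∣a-b : m ℤ∣.∣ a - b

*-distribˡ-- : ∀ c a b → c * (a - b) ≡ c * a - c * b
*-distribˡ-- = solve-∀

module _ {m : ℤ} where

  ≈-reflexive : ∀ {a b} → a ≡ b → a ≈ b [mod m ]
  ≈-reflexive {a} refl =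
    mod∣ (subst (m ℤ∣.∣_) (sym (ℤₚ.+-inverseʳ a)) (ℤ∣.divides 0ℤ (sym (ℤₚ.*-zeroˡ m))))

  ≈-refl : ∀ {a} → a ≈ a [mod m ]
  ≈-refl = ≈-reflexive refl

  ≈-sym : ∀ {a b} → a ≈ b [mod m ] → b ≈ a [mod m ]
  ≈-sym {a} {b} (mod∣ m∣a-b) = mod∣ (subst (m ℤ∣.∣_) (neg a b) (ℤ∣.∣m⇒∣-m m∣a-b))
    where
    neg : ∀ a b → - (a - b) ≡ b - a
    neg = solve-∀

  ≈-trans : ∀ {a b c} → a ≈ b [mod m ] → b ≈ c [mod m ] → a ≈ c [mod m ]
  ≈-trans {a} {b} {c} (mod∣ m∣a-b) (mod∣ m∣b-c) =
    mod∣ (subst (m ℤ∣.∣_) (telescope a b c) (ℤ∣.∣m∣n⇒∣m+n m∣a-b m∣b-c))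
    where
    telescope : ∀ a b c → (a - b) + (b - c) ≡ a - c
    telescope = solve-∀

  ≈-isEquivalence : IsEquivalence (λ a b → a ≈ b [mod m ])
  ≈-isEquivalence = record { refl = ≈-refl ; sym = ≈-sym ; trans = ≈-trans }

≈-setoid : ℤ → Setoid _ _
≈-setoid m = record { isEquivalence = ≈-isEquivalence {m} }

module ≈-Reasoning (m : ℤ) where
  open import Relation.Binary.Reasoning.Setoid (≈-setoid m) public

module _ {m : ℤ} where

  +-cong : ∀ {a b c d} → a ≈ b [mod m ] → c ≈ d [mod m ] → a + c ≈ b + d [mod m ]
  +-cong {a} {b} {c} {d} (mod∣ m∣a-b) (mod∣ m∣c-d) =
    mod∣ (subst (m ℤ∣.∣_) (regroup a b c d) (ℤ∣.∣m∣n⇒∣m+n m∣a-b m∣c-d))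
    where
    regroup : ∀ a b c d → (a - b) + (c - d) ≡ (a + c) - (b + d)
    regroup = solve-∀

  sub-cong : ∀ {a b c d} → a ≈ b [mod m ] → c ≈ d [mod m ] → a - c ≈ b - d [mod m ]
  sub-cong {a} {b} {c} {d} (mod∣ m∣a-b) (mod∣ m∣c-d) =
    mod∣ (subst (m ℤ∣.∣_) (regroup a b c d) (ℤ∣.∣m∣n⇒∣m-n m∣a-b m∣c-d))
    where
    regroup : ∀ a b c d → (a - b) - (c - d) ≡ (a - c) - (b - d)
    regroup = solve-∀

  *-congˡ : ∀ c {a b} → a ≈ b [mod m ] → c * a ≈ c * b [mod m ]
  *-congˡ c {a} {b} (mod∣ m∣a-b) =
    mod∣ (subst (m ℤ∣.∣_) (*-distribˡ-- c a b) (ℤ∣.∣n⇒∣m*n c m∣a-b))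

  *-cong : ∀ {a b c d} → a ≈ b [mod m ] → c ≈ d [mod m ] → a * c ≈ b * d [mod m ]
  *-cong {a} {b} {c} {d} a≈b c≈d = ≈-trans (≈-reflexive (ℤₚ.*-comm a c))
    (≈-trans (*-congˡ c a≈b) (≈-trans (≈-reflexive (ℤₚ.*-comm c b)) (*-congˡ b c≈d)))

  ^-congˡ : ∀ n {a b} → a ≈ b [mod m ] → a ^ n ≈ b ^ n [mod m ]
  ^-congˡ zero    a≈b = ≈-refl
  ^-congˡ (suc n) a≈b = *-cong a≈b (^-congˡ n a≈b)

  ∑-cong-mod : ∀ n {f g : ℕ → ℤ} → (∀ i → i < n → f i ≈ g i [mod m ]) → ∑ n f ≈ ∑ n g [mod m ]
  ∑-cong-mod zero    f≈g = ≈-refl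
  ∑-cong-mod (suc n) f≈g =
    +-cong (∑-cong-mod n (λ i i<n → f≈g i (ℕₚ.m<n⇒m<1+n i<n))) (f≈g n ℕₚ.≤-refl)

  +-multiple : ∀ a k → a + k * m ≈ a [mod m ]
  +-multiple a k = mod∣ (ℤ∣.divides k (cancel a (k * m)))
    where
    cancel : ∀ a x → a + x - a ≡ x
    cancel = solve-∀

  ∣⇒≈0 : ∀ {a} → m ℤ∣.∣ a → a ≈ 0ℤ [mod m ]
  ∣⇒≈0 {a} m∣a = mod∣ (subst (m ℤ∣.∣_) (sym (ℤₚ.+-identityʳ a)) m∣a)

  ≈0⇒∣ : ∀ {a} → a ≈ 0ℤ [mod m ] → m ℤ∣.∣ a
  ≈0⇒∣ {a} (mod∣ m∣a-0) = subst (m ℤ∣.∣_) (ℤₚ.+-identityʳ a) m∣a-0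

  ∑-≈0 : ∀ n {f : ℕ → ℤ} → (∀ i → i < n → f i ≈ 0ℤ [mod m ]) → ∑ n f ≈ 0ℤ [mod m ]
  ∑-≈0 n {f} f≈0 = ≈-trans (∑-cong-mod n f≈0) (≈-reflexive (∑-zero n _ (λ _ _ → refl)))

  ^-≈1 : ∀ {x} n → x ≈ 1ℤ [mod m ] → x ^ n ≈ 1ℤ [mod m ]
  ^-≈1 n x≈1 = ≈-trans (^-congˡ n x≈1) (≈-reflexive (ℤₚ.^-zeroˡ n))

  ∣⇒^≈1 : ∀ {x v e} → x ^ v ≈ 1ℤ [mod m ] → v ∣ e → x ^ e ≈ 1ℤ [mod m ]
  ∣⇒^≈1 {x} {v} x^v≈1 (divides s refl) = ≈-trans
    (≈-reflexive (trans (cong (x ^_) (ℕₚ.*-comm s v)) (sym (ℤₚ.^-*-assoc x v s))))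
    (^-≈1 s x^v≈1)

  ^-reduce : ∀ {x v} → x ^ v ≈ 1ℤ [mod m ] → ∀ a t → x ^ (a ℕ.+ t ℕ.* v) ≈ x ^ a [mod m ]
  ^-reduce {x} {v} x^v≈1 a t = begin
    x ^ (a ℕ.+ t ℕ.* v)   ≡⟨ ℤₚ.^-distribˡ-+-* x a (t ℕ.* v) ⟩
    x ^ a * x ^ (t ℕ.* v) ≈⟨ *-congˡ (x ^ a) (∣⇒^≈1 x^v≈1 (n∣m*n t)) ⟩
    x ^ a * 1ℤ            ≡⟨ ℤₚ.*-identityʳ (x ^ a) ⟩
    x ^ a                 ∎
    where open ≈-Reasoning m

≈⇔-≈0 : ∀ {m a b} → a ≈ b [mod m ] ⇔ a - b ≈ 0ℤ [mod m ]
≈⇔-≈0 = mk⇔ (λ (mod∣ m∣a-b) → ∣⇒≈0 m∣a-b) (λ a-b≈0 → mod∣ (≈0⇒∣ a-b≈0))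

≈-divisor : ∀ {d m a b} → d ℤ∣.∣ m → a ≈ b [mod m ] → a ≈ b [mod d ]
≈-divisor d∣m (mod∣ m∣a-b) = mod∣ (ℤ∣.∣-trans d∣m m∣a-b)

≈-scale : ∀ {m a b} c → a ≈ b [mod + m ] → + c * a ≈ + c * b [mod + (c ℕ.* m) ]
≈-scale {m} {a} {b} c (mod∣ m∣a-b) =
  mod∣ (subst₂ ℤ∣._∣_ (sym (ℤₚ.pos-* c m)) (*-distribˡ-- (+ c) a b) (ℤ∣.*-monoʳ-∣ (+ c) m∣a-b))

∣⇒*≈0 : ∀ {m c} y → m ∣ c → + c * y ≈ 0ℤ [mod + m ]
∣⇒*≈0 {m} {c} y m∣c = ∣⇒≈0 (ℤ∣.∣m⇒∣m*n y (ℤ∣.∣ᵤ⇒∣ {+ m} {+ c} m∣c))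

≈1⇔∣∸1 : ∀ {m x} → 0 < x → + x ≈ 1ℤ [mod + m ] ⇔ m ∣ x ∸ 1
≈1⇔∣∸1 {m} {suc x} _ = mk⇔
  (λ (mod∣ m∣x+1-1) → ℤ∣.∣⇒∣ᵤ (subst (+ m ℤ∣.∣_) (decrement (+ x)) m∣x+1-1))
  (λ m∣x → mod∣ (subst (+ m ℤ∣.∣_) (sym (decrement (+ x))) (ℤ∣.∣ᵤ⇒∣ {+ m} {+ x} m∣x)))
  where
  decrement : ∀ X → 1ℤ + X - 1ℤ ≡ X
  decrement = solve-∀

coprime⇒≈0 : ∀ {m n a} → Coprime m n →
             a ≈ 0ℤ [mod + m ] → a ≈ 0ℤ [mod + n ] → a ≈ 0ℤ [mod + (m ℕ.* n) ]
coprime⇒≈0 {m} {n} {a} m⊥n a≈0[m] a≈0[n] = ∣⇒≈0 (ℤ∣.∣ᵤ⇒∣ {+ (m ℕ.* n)} {a}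
  (coprime⇒*∣ m⊥n (ℤ∣.∣⇒∣ᵤ (≈0⇒∣ a≈0[m])) (ℤ∣.∣⇒∣ᵤ (≈0⇒∣ a≈0[n]))))

prime∣*⇒∣ : ∀ {p} → Prime p → ∀ a b → + p ℤ∣.∣ a * b → + p ℤ∣.∣ a ⊎ + p ℤ∣.∣ b
prime∣*⇒∣ pp a b p∣ab
  with euclidsLemma ℤ.∣ a ∣ ℤ.∣ b ∣ pp (subst (_ ∣_) (ℤₚ.abs-* a b) (ℤ∣.∣⇒∣ᵤ p∣ab))
... | inj₁ p∣a = inj₁ (ℤ∣.∣ᵤ⇒∣ p∣a)
... | inj₂ p∣b = inj₂ (ℤ∣.∣ᵤ⇒∣ p∣b)

*-cancelˡ-≈-prime : ∀ {p c a b} → Prime p → ¬ + p ℤ∣.∣ c →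
                    c * a ≈ c * b [mod + p ] → a ≈ b [mod + p ]
*-cancelˡ-≈-prime {p} {c} {a} {b} pp p∤c (mod∣ p∣ca-cb) =
  [ (λ p∣c → ⊥-elim (p∤c p∣c)) , mod∣ ]′
  (prime∣*⇒∣ pp c (a - b) (subst (+ p ℤ∣.∣_) (sym (*-distribˡ-- c a b)) p∣ca-cb))

≈0⇔-scaled : ∀ {K m a b} .{{_ : ℕ.NonZero K}} → a ≈ + K * b [mod + (K ℕ.* m) ] →
             a ≈ 0ℤ [mod + (K ℕ.* m) ] ⇔ b ≈ 0ℤ [mod + m ]
≈0⇔-scaled {K} {m} {a} {b} a≈Kb = mk⇔
  (λ a≈0 → ∣⇒≈0 (ℤ∣.*-cancelˡ-∣ (+ K) (subst (ℤ∣._∣ + K * b) (ℤₚ.pos-* K m)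
                                             (≈0⇒∣ (≈-trans (≈-sym a≈Kb) a≈0)))))
  (λ b≈0 → ≈-trans a≈Kb (≈-trans (≈-scale K b≈0) (≈-reflexive (ℤₚ.*-zeroʳ (+ K)))))

pos-suc : ∀ r → + suc r ≡ + r + 1ℤ
pos-suc r = trans (ℤₚ.pos-+ 1 r) (ℤₚ.+-comm 1ℤ (+ r))

pos-^ : ∀ x n → + (x ℕ.^ n) ≡ (+ x) ^ n
pos-^ x zero    = refl
pos-^ x (suc n) = trans (ℤₚ.pos-* x (x ℕ.^ n)) (cong (+ x *_) (pos-^ x n))

pos-^*^ : ∀ x y a b → + (x ℕ.^ a ℕ.* y ℕ.^ b) ≡ (+ x) ^ a * (+ y) ^ b
pos-^*^ x y a b = trans (ℤₚ.pos-* (x ℕ.^ a) (y ℕ.^ b)) (cong₂ _*_ (pos-^ x a) (pos-^ y b))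

0ℤ^-positive : ∀ {k} → 0 < k → 0ℤ ^ k ≡ 0ℤ
0ℤ^-positive {suc k} _ = ℤₚ.*-zeroˡ (0ℤ ^ k)

-- The library's binomial theorem uses Fin-indexed sums, the semiring's own powers and ℕ-multiples;
-- these lemmas translate them to ∑, ℤ._^_ and ℤ._*_.
semiring-^≡^ : ∀ x n → x SemiringExp.^ n ≡ x ^ n
semiring-^≡^ x zero    = refl
semiring-^≡^ x (suc n) = cong (x *_) (semiring-^≡^ x n)

×≡* : ∀ n x → n Multiple.× x ≡ + n * x
×≡* zero    x = refl
×≡* (suc n) x = trans (cong (λ s → x + s) (×≡* n x)) (step (+ n) x)
  where
  step : ∀ a x → x + a * x ≡ (1ℤ + a) * x
  step = solve-∀

finSum≡∑ : ∀ n (f : ℕ → ℤ) → FinSum.sum {n} (λ i → f (toℕ i)) ≡ ∑ n f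
finSum≡∑ zero    f = refl
finSum≡∑ (suc n) f =
  trans (cong (λ s → f 0 + s) (finSum≡∑ n (λ i → f (suc i)))) (sym (∑-suc n f))

binomial-theorem : ∀ n x → (x + 1ℤ) ^ n ≡ ∑[ k < suc n ] (+ (n C k) * x ^ k)
binomial-theorem n x = begin
  (x + 1ℤ) ^ n                                   ≡⟨ semiring-^≡^ (x + 1ℤ) n ⟨
  (x + 1ℤ) SemiringExp.^ n                       ≡⟨ Binomial.theorem n x 1ℤ ⟩
  Binomial.binomialExpansion x 1ℤ n              ≡⟨ FinSum.sum-cong-≗ {suc n} term ⟩
  FinSum.sum {suc n} (λ k → + (n C toℕ k) * x ^ toℕ k) ≡⟨ finSum≡∑ (suc n) _ ⟩
  ∑[ k < suc n ] (+ (n C k) * x ^ k)              ∎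
  where
  open ≡-Reasoning
  term : ∀ k → Binomial.binomialTerm x 1ℤ n k ≡ + (n C toℕ k) * x ^ toℕ k
  term k = begin
    (n C j) Multiple.× (x SemiringExp.^ j * 1ℤ SemiringExp.^ (n ∸ j))
      ≡⟨ ×≡* (n C j) _ ⟩
    + (n C j) * (x SemiringExp.^ j * 1ℤ SemiringExp.^ (n ∸ j))
      ≡⟨ cong₂ (λ a b → + (n C j) * (a * b))
           (semiring-^≡^ x j) (trans (semiring-^≡^ 1ℤ (n ∸ j)) (ℤₚ.^-zeroˡ (n ∸ j))) ⟩
    + (n C j) * (x ^ j * 1ℤ)
      ≡⟨ cong (+ (n C j) *_) (ℤₚ.*-identityʳ (x ^ j)) ⟩
    + (n C j) * x ^ j
      ∎
    where j = toℕ k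

^-distribʳ-* : ∀ x y n → (x * y) ^ n ≡ x ^ n * y ^ n
^-distribʳ-* x y n = begin
  (x * y) ^ n                             ≡⟨ semiring-^≡^ (x * y) n ⟨
  (x * y) SemiringExp.^ n                 ≡⟨ CommutativeSemiringExp.^-distrib-* x y n ⟩
  x SemiringExp.^ n * y SemiringExp.^ n   ≡⟨ cong₂ _*_ (semiring-^≡^ x n) (semiring-^≡^ y n) ⟩
  x ^ n * y ^ n                           ∎
  where open ≡-Reasoning

binomial-difference : ∀ m x → (x + 1ℤ) ^ m - x ^ m ≡ ∑[ j < m ] (+ (m C j) * x ^ j)
binomial-difference m x = begin
  (x + 1ℤ) ^ m - x ^ m                               ≡⟨ cong (_- x ^ m) (binomial-theorem m x) ⟩
  ∑[ j < m ] (+ (m C j) * x ^ j) + + (m C m) * x ^ m - x ^ m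
    ≡⟨ cong (λ k → ∑[ j < m ] (+ (m C j) * x ^ j) + + k * x ^ m - x ^ m) (nCn≡1 m) ⟩
  ∑[ j < m ] (+ (m C j) * x ^ j) + 1ℤ * x ^ m - x ^ m ≡⟨ cancel _ (x ^ m) ⟩
  ∑[ j < m ] (+ (m C j) * x ^ j)                     ∎
  where
  open ≡-Reasoning
  cancel : ∀ a b → a + 1ℤ * b - b ≡ a
  cancel = solve-∀

[1+n]Cn≡1+n : ∀ n → suc n C n ≡ suc n
[1+n]Cn≡1+n n = begin
  suc n C n             ≡⟨ nCk≡nC[n∸k] (ℕₚ.n≤1+n n) ⟩
  suc n C (suc n ∸ n)   ≡⟨ cong (suc n C_) (ℕₚ.m+n∸n≡m 1 n) ⟩
  suc n C 1             ≡⟨ nC1≡n (suc n) ⟩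
  suc n                 ∎
  where open ≡-Reasoning

-- Fermat's little theorem

+1-^-prime : ∀ {p} → Prime p → ∀ x → (x + 1ℤ) ^ p ≈ x ^ p + 1ℤ [mod + p ]
+1-^-prime {p@(suc m)} pp x = begin
  (x + 1ℤ) ^ p                          ≡⟨ binomial-theorem p x ⟩
  ∑ (suc m) c + c p                     ≡⟨ cong (_+ c p) (∑-suc m c) ⟩
  (c 0 + ∑[ i < m ] c (suc i)) + c p    ≈⟨ +-cong (+-cong (≈-refl {a = c 0}) inner≈0)
                                                   (≈-refl {a = c p}) ⟩
  (c 0 + 0ℤ) + c p                      ≡⟨ cong (λ k → c 0 + 0ℤ + + k * x ^ p) (nCn≡1 p) ⟩
  (1ℤ * 1ℤ + 0ℤ) + 1ℤ * x ^ p           ≡⟨ tidy (x ^ p) ⟩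
  x ^ p + 1ℤ                            ∎
  where
  open ≈-Reasoning (+ p)
  c : ℕ → ℤ
  c k = + (p C k) * x ^ k
  inner≈0 : ∑[ i < m ] c (suc i) ≈ 0ℤ [mod + p ]
  inner≈0 = ∑-≈0 m (λ i i<m → ∣⇒*≈0 (x ^ suc i) (prime∣pCk pp (s≤s z≤n) (s≤s i<m)))
  tidy : ∀ y → (1ℤ * 1ℤ + 0ℤ) + 1ℤ * y ≡ y + 1ℤ
  tidy = solve-∀

fermat-little : ∀ {p} → Prime p → ∀ x → (+ x) ^ p ≈ + x [mod + p ]
fermat-little {suc m} pp zero    = ≈-refl
fermat-little {p}     pp (suc x) = begin
  (+ suc x) ^ p    ≡⟨ cong (_^ p) (pos-suc x) ⟩
  (+ x + 1ℤ) ^ p   ≈⟨ +1-^-prime pp (+ x) ⟩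
  (+ x) ^ p + 1ℤ   ≈⟨ +-cong (fermat-little pp x) ≈-refl ⟩
  + x + 1ℤ         ≡⟨ pos-suc x ⟨
  + suc x          ∎
  where open ≈-Reasoning (+ p)

fermat : ∀ {p x} → Prime p → ¬ p ∣ x → (+ x) ^ (p ∸ 1) ≈ 1ℤ [mod + p ]
fermat {p@(suc m)} {x} pp p∤x = *-cancelˡ-≈-prime {c = + x} pp (λ p∣x → p∤x (ℤ∣.∣⇒∣ᵤ p∣x)) (begin
  + x * (+ x) ^ m ≈⟨ fermat-little pp x ⟩
  + x             ≡⟨ ℤₚ.*-identityʳ (+ x) ⟨
  + x * 1ℤ        ∎)
  where open ≈-Reasoning (+ p)

-- Power sums modulo a prime

powerSum : ℕ → ℕ → ℤ
powerSum n k = ∑[ r < n ] ((+ r) ^ k)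

powerSum-recurrence : ∀ n k → (+ n) ^ suc k ≡ ∑[ j < suc k ] (+ (suc k C j) * powerSum n j)
powerSum-recurrence n k = begin
  (+ n) ^ m                                          ≡⟨ ℤₚ.+-identityʳ _ ⟨
  (+ n) ^ m - 0ℤ ^ m                                 ≡⟨ ∑-telescope n (λ r → (+ r) ^ m) ⟨
  ∑[ r < n ] ((+ suc r) ^ m - (+ r) ^ m)
    ≡⟨ ∑-cong n (λ r _ → trans (cong (λ y → y ^ m - (+ r) ^ m) (pos-suc r))
                                (binomial-difference m (+ r))) ⟩
  ∑[ r < n ] ∑[ j < m ] (+ (m C j) * (+ r) ^ j)      ≡⟨ ∑-comm n m _ ⟩
  ∑[ j < m ] ∑[ r < n ] (+ (m C j) * (+ r) ^ j)      ≡⟨ ∑-cong m (λ j _ → ∑-*ˡ n (+ (m C j)) _) ⟩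
  ∑[ j < m ] (+ (m C j) * powerSum n j)              ∎
  where
  open ≡-Reasoning
  m = suc k

powerSum-≈0 : ∀ {p} → Prime p → ∀ k → suc k < p → powerSum p k ≈ 0ℤ [mod + p ]
powerSum-≈0 {p} pp = <-rec (λ k → suc k < p → powerSum p k ≈ 0ℤ [mod + p ]) step
  where
  step : ∀ k → (∀ {j} → j < k → suc j < p → powerSum p j ≈ 0ℤ [mod + p ]) →
         suc k < p → powerSum p k ≈ 0ℤ [mod + p ]
  step k ih 1+k<p = *-cancelˡ-≈-prime {c = + suc k} pp
    (λ p∣1+k → >⇒∤ 1+k<p (ℤ∣.∣⇒∣ᵤ p∣1+k)) (begin
      + suc k * powerSum p k                          ≡⟨ cong (λ c → + c * powerSum p k) ([1+n]Cn≡1+n k) ⟨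
      + (suc k C k) * powerSum p k                    ≡⟨ isolate lower _ ⟩
      (lower + + (suc k C k) * powerSum p k) - lower  ≡⟨ cong (_- lower) (powerSum-recurrence p k) ⟨
      (+ p) ^ suc k - lower                           ≈⟨ sub-cong p^[1+k]≈0 lower≈0 ⟩
      0ℤ - 0ℤ                                         ≡⟨ ℤₚ.*-zeroʳ (+ suc k) ⟨
      + suc k * 0ℤ                                    ∎)
    where
    open ≈-Reasoning (+ p)
    lower = ∑[ j < k ] (+ (suc k C j) * powerSum p j)
    isolate : ∀ a b → b ≡ (a + b) - a
    isolate = solve-∀
    p^[1+k]≈0 : (+ p) ^ suc k ≈ 0ℤ [mod + p ]
    p^[1+k]≈0 = ∣⇒≈0 (ℤ∣.∣m⇒∣m*n ((+ p) ^ k) ℤ∣.∣-refl)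
    lower≈0 : lower ≈ 0ℤ [mod + p ]
    lower≈0 = ∑-≈0 k (λ j j<k → ≈-trans
      (*-congˡ (+ (suc k C j)) (ih j<k (ℕₚ.<-trans (s≤s j<k) 1+k<p)))
      (≈-reflexive (ℤₚ.*-zeroʳ (+ (suc k C j)))))

powerSum-≈0-∤ : ∀ {p e} → Prime p → 0 < e → ¬ (p ∸ 1) ∣ e → powerSum p e ≈ 0ℤ [mod + p ]
powerSum-≈0-∤ {p@(suc (suc n))} {e} pp 0<e p∸1∤e = begin
  powerSum p e    ≈⟨ ∑-cong-mod p reduce ⟩
  powerSum p e′   ≈⟨ powerSum-≈0 pp e′ (s≤s (m%n<n e (suc n))) ⟩
  0ℤ              ∎
  where
  open ≈-Reasoning (+ p)
  e′ = e % suc n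
  0<e′ : 0 < e′
  0<e′ with e % suc n in e%[p∸1]≡
  ... | zero  = ⊥-elim (p∸1∤e (m%n≡0⇒n∣m e (suc n) e%[p∸1]≡))
  ... | suc _ = s≤s z≤n
  reduce : ∀ r → r < p → (+ r) ^ e ≈ (+ r) ^ e′ [mod + p ]
  reduce zero    _   = ≈-reflexive (trans (0ℤ^-positive 0<e) (sym (0ℤ^-positive 0<e′)))
  reduce (suc r) r<p = begin
    (+ suc r) ^ e                             ≡⟨ cong ((+ suc r) ^_) (m≡m%n+[m/n]*n e (suc n)) ⟩
    (+ suc r) ^ (e′ ℕ.+ e / suc n ℕ.* suc n)  ≈⟨ ^-reduce (fermat pp (>⇒∤ r<p)) e′ (e / suc n) ⟩
    (+ suc r) ^ e′                            ∎

infix 9 [_]·_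

[_]·_ : ∀ {P : Set} → Dec P → ℤ → ℤ
[ yes _ ]· z = z
[ no _  ]· z = 0ℤ

module _ {P : Set} where

  []·-⇔ : ∀ {Q : Set} (P? : Dec P) (Q? : Dec Q) → (P → Q) → (Q → P) → ∀ z → [ P? ]· z ≡ [ Q? ]· z
  []·-⇔ (yes _) (yes _) _   _   z = refl
  []·-⇔ (no _)  (no _)  _   _   z = refl
  []·-⇔ (yes p) (no ¬q) p→q _   z = ⊥-elim (¬q (p→q p))
  []·-⇔ (no ¬p) (yes q) _   q→p z = ⊥-elim (¬p (q→p q))

  []·-yes : ∀ (P? : Dec P) → P → ∀ z → [ P? ]· z ≡ z
  []·-yes (yes _) _ z = refl
  []·-yes (no ¬p) p z = ⊥-elim (¬p p)

  []·-no : ∀ (P? : Dec P) → ¬ P → ∀ z → [ P? ]· z ≡ 0ℤ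
  []·-no (yes p) ¬p z = ⊥-elim (¬p p)
  []·-no (no _)  _  z = refl

  []·-* : ∀ (P? : Dec P) c z → [ P? ]· (c * z) ≡ c * [ P? ]· z
  []·-* (yes _) c z = refl
  []·-* (no _)  c z = sym (ℤₚ.*-zeroʳ c)

  []·-- : ∀ (P? : Dec P) a b → [ P? ]· (a - b) ≡ [ P? ]· a - [ P? ]· b
  []·-- (yes _) a b = refl
  []·-- (no _)  a b = refl

  []·-∑ : ∀ (P? : Dec P) n (f : ℕ → ℤ) → ∑[ t < n ] ([ P? ]· f t) ≡ [ P? ]· ∑ n f
  []·-∑ (yes _) n f = refl
  []·-∑ (no _)  n f = ∑-zero n _ (λ _ _ → refl)

  []·-swap : ∀ {Q : Set} (P? : Dec P) (Q? : Dec Q) z → [ P? ]· ([ Q? ]· z) ≡ [ Q? ]· ([ P? ]· z)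
  []·-swap (yes _) (yes _) z = refl
  []·-swap (yes _) (no _)  z = refl
  []·-swap (no _)  (yes _) z = refl
  []·-swap (no _)  (no _)  z = refl

  []·-cong-mod : ∀ (P? : Dec P) {m a b} → a ≈ b [mod m ] → [ P? ]· a ≈ [ P? ]· b [mod m ]
  []·-cong-mod (yes _) a≈b = a≈b
  []·-cong-mod (no _)  a≈b = ≈-refl

-- The unit power sum and its lifting along odd factors

excessTerm : ℕ → ℕ → ℤ
excessTerm e k = (+ k) ^ e - 1ℤ

-- ∑_{k<n, gcd(k,n)=1} k^e minus φ(n), whence the name.
excess : ℕ → ℕ → ℤ
excess e n = ∑[ k < n ] ([ gcd k n ≟ 1 ]· excessTerm e k)

excessTerm-periodic : ∀ e p r t → excessTerm e (r ℕ.+ t ℕ.* p) ≈ excessTerm e r [mod + p ]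
excessTerm-periodic e p r t = sub-cong (^-congˡ e r+tp≈r) ≈-refl
  where
  r+tp≈r : + (r ℕ.+ t ℕ.* p) ≈ + r [mod + p ]
  r+tp≈r = ≈-trans
    (≈-reflexive (trans (ℤₚ.pos-+ r (t ℕ.* p)) (cong (λ y → + r + y) (ℤₚ.pos-* t p))))
    (+-multiple (+ r) (+ t))

∑-excessTerm-multiples : ∀ n e q →
  ∑[ t < n ] excessTerm e (t ℕ.* q) ≡ (+ q) ^ e * powerSum n e - + n * 1ℤ
∑-excessTerm-multiples n e q = begin
  ∑[ t < n ] excessTerm e (t ℕ.* q)
    ≡⟨ ∑-cong n (λ t _ → cong (_- 1ℤ) (scale t)) ⟩
  ∑[ t < n ] ((+ q) ^ e * (+ t) ^ e - 1ℤ)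
    ≡⟨ ∑-distrib-- n ⟩
  ∑[ t < n ] ((+ q) ^ e * (+ t) ^ e) - ∑[ _ < n ] 1ℤ
    ≡⟨ cong₂ _-_ (∑-*ˡ n ((+ q) ^ e) _) (∑-const n 1ℤ) ⟩
  (+ q) ^ e * powerSum n e - + n * 1ℤ
    ∎
  where
  open ≡-Reasoning
  scale : ∀ t → (+ (t ℕ.* q)) ^ e ≡ (+ q) ^ e * (+ t) ^ e
  scale t = trans (cong (_^ e) (ℤₚ.pos-* t q))
                  (trans (^-distribʳ-* (+ t) (+ q) e) (ℤₚ.*-comm ((+ t) ^ e) ((+ q) ^ e)))

^-≈-linear : ∀ a x e → (a + x) ^ e ≈ a ^ e + + e * x * a ^ (e ∸ 1) [mod x * x ]
^-≈-linear a x zero          = ≈-reflexive (exact a x)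
  where
  exact : ∀ a x → 1ℤ ≡ 1ℤ + 0ℤ * x * 1ℤ
  exact = solve-∀
^-≈-linear a x (suc zero)    = ≈-reflexive (exact a x)
  where
  exact : ∀ a x → (a + x) * 1ℤ ≡ a * 1ℤ + 1ℤ * x * 1ℤ
  exact = solve-∀
^-≈-linear a x (suc (suc e)) = begin
  (a + x) * (a + x) ^ suc e                            ≈⟨ *-congˡ (a + x) (^-≈-linear a x (suc e)) ⟩
  (a + x) * (a ^ suc e + + suc e * x * a ^ e)          ≡⟨ expand a x (+ suc e) (a ^ e) ⟩
  a ^ suc (suc e) + + suc (suc e) * x * a ^ suc e + (+ suc e * a ^ e) * (x * x)
                                                       ≈⟨ +-multiple _ (+ suc e * a ^ e) ⟩
  a ^ suc (suc e) + + suc (suc e) * x * a ^ suc e      ∎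
  where
  open ≈-Reasoning (x * x)
  expand : ∀ a x E A → (a + x) * (a * A + E * x * A)
                     ≡ a * (a * A) + (1ℤ + E) * x * (a * A) + (E * A) * (x * x)
  expand = solve-∀

-- + suc k and 1ℤ + + k are definitionally equal; this lets the ring solver see the successors.
∑-range-odd : ∀ h → ∑[ t < suc (h ℕ.* 2) ] (+ t) ≡ + suc (h ℕ.* 2) * + h
∑-range-odd zero    = refl
∑-range-odd (suc h) = begin
  ∑[ t < suc (h ℕ.* 2) ] (+ t) + (1ℤ + X) + (1ℤ + (1ℤ + X))
    ≡⟨ cong (λ s → s + (1ℤ + X) + (1ℤ + (1ℤ + X))) (∑-range-odd h) ⟩
  (1ℤ + X) * + h + (1ℤ + X) + (1ℤ + (1ℤ + X))
    ≡⟨ cong (λ X → (1ℤ + X) * + h + (1ℤ + X) + (1ℤ + (1ℤ + X))) (ℤₚ.pos-* h 2) ⟩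
  (1ℤ + + h * + 2) * + h + (1ℤ + + h * + 2) + (1ℤ + (1ℤ + + h * + 2))
    ≡⟨ expand (+ h) ⟩
  (1ℤ + (1ℤ + (1ℤ + + h * + 2))) * (1ℤ + + h)
    ≡⟨ cong (λ X → (1ℤ + (1ℤ + (1ℤ + X))) * (1ℤ + + h)) (ℤₚ.pos-* h 2) ⟨
  (1ℤ + (1ℤ + (1ℤ + X))) * (1ℤ + + h)
    ∎
  where
  open ≡-Reasoning
  X = + (h ℕ.* 2)
  expand : ∀ H → (1ℤ + H * + 2) * H + (1ℤ + H * + 2) + (1ℤ + (1ℤ + H * + 2))
               ≡ (1ℤ + (1ℤ + (1ℤ + H * + 2))) * (1ℤ + H)
  expand = solve-∀

odd⇒∣∑range : ∀ {r} → ¬ 2 ∣ r → + r ℤ∣.∣ ∑[ t < r ] (+ t)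
odd⇒∣∑range {r} 2∤r with odd⇒≡1+2h r 2∤r
... | h , refl = ℤ∣.divides (+ h) (trans (∑-range-odd h) (ℤₚ.*-comm (+ suc (h ℕ.* 2)) (+ h)))

excessTerm-shift-≈ : ∀ e {r M} → r ∣ M → ∀ s t →
  excessTerm e (s ℕ.+ t ℕ.* M) ≈ excessTerm e s + + e * (+ s) ^ (e ∸ 1) * + M * + t [mod + (r ℕ.* M) ]
excessTerm-shift-≈ e {r} {M} r∣M s t = begin
  (+ (s ℕ.+ t ℕ.* M)) ^ e - 1ℤ           ≡⟨ cong (λ y → y ^ e - 1ℤ) s+tM≡S+X ⟩
  (S + X) ^ e - 1ℤ                        ≈⟨ sub-cong (≈-divisor rM∣X*X (^-≈-linear S X e)) ≈-refl ⟩
  S ^ e + + e * X * S ^ (e ∸ 1) - 1ℤ      ≡⟨ regroup (+ e) (+ t) (+ M) (S ^ e) (S ^ (e ∸ 1)) ⟩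
  S ^ e - 1ℤ + + e * S ^ (e ∸ 1) * + M * + t ∎
  where
  open ≈-Reasoning (+ (r ℕ.* M))
  S = + s
  X = + t * + M
  s+tM≡S+X : + (s ℕ.+ t ℕ.* M) ≡ S + X
  s+tM≡S+X = trans (ℤₚ.pos-+ s (t ℕ.* M)) (cong (λ y → S + y) (ℤₚ.pos-* t M))
  rM∣X*X : + (r ℕ.* M) ℤ∣.∣ X * X
  rM∣X*X = subst₂ ℤ∣._∣_ (sym (ℤₚ.pos-* r M)) (square (+ t) (+ M))
    (ℤ∣.∣n⇒∣m*n (+ t * + t) (ℤ∣.*-monoˡ-∣ (+ M) (ℤ∣.∣ᵤ⇒∣ {+ r} {+ M} r∣M)))
    where
    square : ∀ t M → t * t * (M * M) ≡ t * M * (t * M)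
    square = solve-∀
  regroup : ∀ E T M A B → A + E * (T * M) * B - 1ℤ ≡ A - 1ℤ + E * B * M * T
  regroup = solve-∀

∑-excessTerm-shifts : ∀ e {r M} → ¬ 2 ∣ r → r ∣ M → ∀ s →
  ∑[ t < r ] excessTerm e (s ℕ.+ t ℕ.* M) ≈ + r * excessTerm e s [mod + (r ℕ.* M) ]
∑-excessTerm-shifts e {r} {M} 2∤r r∣M s = begin
  ∑[ t < r ] excessTerm e (s ℕ.+ t ℕ.* M)
    ≈⟨ ∑-cong-mod r (λ t _ → excessTerm-shift-≈ e r∣M s t) ⟩
  ∑[ t < r ] (excessTerm e s + D * + t)
    ≡⟨ ∑-distrib-+ r ⟩
  ∑[ _ < r ] excessTerm e s + ∑[ t < r ] (D * + t)
    ≡⟨ cong₂ _+_ (∑-const r _) (∑-*ˡ r D (λ t → + t)) ⟩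
  + r * excessTerm e s + D * ∑[ t < r ] (+ t)
    ≈⟨ +-cong (≈-refl {a = + r * excessTerm e s}) D*∑≈0 ⟩
  + r * excessTerm e s + 0ℤ
    ≡⟨ ℤₚ.+-identityʳ _ ⟩
  + r * excessTerm e s
    ∎
  where
  open ≈-Reasoning (+ (r ℕ.* M))
  D = + e * (+ s) ^ (e ∸ 1) * + M
  D*∑≈0 : D * ∑[ t < r ] (+ t) ≈ 0ℤ [mod + (r ℕ.* M) ]
  D*∑≈0 = ∣⇒≈0 (subst₂ ℤ∣._∣_ M*r≡rM (reassociate (+ e * (+ s) ^ (e ∸ 1)) (+ M) _)
    (ℤ∣.∣n⇒∣m*n (+ e * (+ s) ^ (e ∸ 1)) (ℤ∣.*-monoʳ-∣ (+ M) (odd⇒∣∑range 2∤r))))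
    where
    M*r≡rM : + M * + r ≡ + (r ℕ.* M)
    M*r≡rM = trans (ℤₚ.*-comm (+ M) (+ r)) (sym (ℤₚ.pos-* r M))
    reassociate : ∀ a b c → a * (b * c) ≡ a * b * c
    reassociate = solve-∀

excess-lift : ∀ e {r M} → ¬ 2 ∣ r → r ∣ M → excess e (r ℕ.* M) ≈ + r * excess e M [mod + (r ℕ.* M) ]
excess-lift e {r} {M} 2∤r r∣M = begin
  excess e (r ℕ.* M)
    ≡⟨ ∑-blocks M r _ ⟩
  ∑[ t < r ] ∑[ s < M ] ([ gcd (s ℕ.+ t ℕ.* M) (r ℕ.* M) ≟ 1 ]· excessTerm e (s ℕ.+ t ℕ.* M))
    ≡⟨ ∑-cong r (λ t _ → ∑-cong M (λ s _ → unshift t s _)) ⟩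
  ∑[ t < r ] ∑[ s < M ] ([ gcd s M ≟ 1 ]· excessTerm e (s ℕ.+ t ℕ.* M))
    ≡⟨ ∑-comm r M _ ⟩
  ∑[ s < M ] ∑[ t < r ] ([ gcd s M ≟ 1 ]· excessTerm e (s ℕ.+ t ℕ.* M))
    ≡⟨ ∑-cong M (λ s _ → []·-∑ (gcd s M ≟ 1) r _) ⟩
  ∑[ s < M ] ([ gcd s M ≟ 1 ]· ∑[ t < r ] excessTerm e (s ℕ.+ t ℕ.* M))
    ≈⟨ ∑-cong-mod M (λ s _ → []·-cong-mod (gcd s M ≟ 1) (∑-excessTerm-shifts e 2∤r r∣M s)) ⟩
  ∑[ s < M ] ([ gcd s M ≟ 1 ]· (+ r * excessTerm e s))
    ≡⟨ ∑-cong M (λ s _ → []·-* (gcd s M ≟ 1) (+ r) _) ⟩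
  ∑[ s < M ] (+ r * [ gcd s M ≟ 1 ]· excessTerm e s)
    ≡⟨ ∑-*ˡ M (+ r) _ ⟩
  + r * excess e M
    ∎
  where
  open ≈-Reasoning (+ (r ℕ.* M))
  unshift : ∀ t s z → [ gcd (s ℕ.+ t ℕ.* M) (r ℕ.* M) ≟ 1 ]· z ≡ [ gcd s M ≟ 1 ]· z
  unshift t s = []·-⇔ _ _
    (λ gcd≡1 → coprime⇒gcd≡1 (coprime-shift⇒ {s} t r (gcd≡1⇒coprime gcd≡1)))
    (λ gcd≡1 → coprime⇒gcd≡1 (coprime-shift⇐ {s} t r∣M (gcd≡1⇒coprime gcd≡1)))

excess-lift-^ : ∀ e {r M} → ¬ 2 ∣ r → r ∣ M → ∀ i →
  excess e (r ℕ.^ i ℕ.* M) ≈ + (r ℕ.^ i) * excess e M [mod + (r ℕ.^ i ℕ.* M) ]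
excess-lift-^ e {r} {M} 2∤r r∣M zero = subst (λ N → excess e N ≈ 1ℤ * excess e M [mod + N ])
  (sym (ℕₚ.*-identityˡ M)) (≈-reflexive (sym (ℤₚ.*-identityˡ (excess e M))))
excess-lift-^ e {r} {M} 2∤r r∣M (suc i) =
  subst (λ N → excess e N ≈ + (r ℕ.^ suc i) * excess e M [mod + N ])
        (sym (ℕₚ.*-assoc r (r ℕ.^ i) M)) (begin
    excess e (r ℕ.* (r ℕ.^ i ℕ.* M))       ≈⟨ excess-lift e 2∤r (∣n⇒∣m*n (r ℕ.^ i) r∣M) ⟩
    + r * excess e (r ℕ.^ i ℕ.* M)         ≈⟨ ≈-scale r (excess-lift-^ e 2∤r r∣M i) ⟩
    + r * (+ (r ℕ.^ i) * excess e M)       ≡⟨ ℤₚ.*-assoc (+ r) (+ (r ℕ.^ i)) (excess e M) ⟨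
    + r * + (r ℕ.^ i) * excess e M         ≡⟨ cong (_* excess e M) (ℤₚ.pos-* r (r ℕ.^ i)) ⟨
    + (r ℕ.^ suc i) * excess e M           ∎)
  where open ≈-Reasoning (+ (r ℕ.* (r ℕ.^ i ℕ.* M)))

excess-lift-pq : ∀ e {p q} → ¬ 2 ∣ p → ¬ 2 ∣ q → ∀ i j →
  excess e (p ℕ.^ i ℕ.* q ℕ.^ j ℕ.* (p ℕ.* q))
    ≈ + (p ℕ.^ i ℕ.* q ℕ.^ j) * excess e (p ℕ.* q) [mod + (p ℕ.^ i ℕ.* q ℕ.^ j ℕ.* (p ℕ.* q)) ]
excess-lift-pq e {p} {q} 2∤p 2∤q i j =
  subst (λ N → excess e N ≈ + (pⁱ ℕ.* qʲ) * excess e (p ℕ.* q) [mod + N ])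
        (sym (ℕₚ.*-assoc pⁱ qʲ (p ℕ.* q))) (begin
    excess e (pⁱ ℕ.* (qʲ ℕ.* (p ℕ.* q)))
      ≈⟨ excess-lift-^ e 2∤p (∣n⇒∣m*n qʲ (m∣m*n q)) i ⟩
    + pⁱ * excess e (qʲ ℕ.* (p ℕ.* q))
      ≈⟨ ≈-scale pⁱ (excess-lift-^ e 2∤q (n∣m*n p) j) ⟩
    + pⁱ * (+ qʲ * excess e (p ℕ.* q))
      ≡⟨ ℤₚ.*-assoc (+ pⁱ) (+ qʲ) (excess e (p ℕ.* q)) ⟨
    + pⁱ * + qʲ * excess e (p ℕ.* q)
      ≡⟨ cong (_* excess e (p ℕ.* q)) (ℤₚ.pos-* pⁱ qʲ) ⟨
    + (pⁱ ℕ.* qʲ) * excess e (p ℕ.* q)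
      ∎)
  where
  pⁱ = p ℕ.^ i
  qʲ = q ℕ.^ j
  open ≈-Reasoning (+ (pⁱ ℕ.* (qʲ ℕ.* (p ℕ.* q))))

excess-≈0⇔excess-pq-≈0 : ∀ e {p q} → Prime p → Prime q → ¬ 2 ∣ p → ¬ 2 ∣ q → ∀ i j →
  excess e (p ℕ.^ suc i ℕ.* q ℕ.^ suc j) ≈ 0ℤ [mod + (p ℕ.^ suc i ℕ.* q ℕ.^ suc j) ]
    ⇔ excess e (p ℕ.* q) ≈ 0ℤ [mod + (p ℕ.* q) ]
excess-≈0⇔excess-pq-≈0 e {p} {q} pp pq 2∤p 2∤q i j =
  subst (λ N → excess e N ≈ 0ℤ [mod + N ] ⇔ excess e (p ℕ.* q) ≈ 0ℤ [mod + (p ℕ.* q) ])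
        (sym (regroup p q (p ℕ.^ i) (q ℕ.^ j)))
        (≈0⇔-scaled {{nonZero}} (excess-lift-pq e 2∤p 2∤q i j))
  where
  nonZero : ℕ.NonZero (p ℕ.^ i ℕ.* q ℕ.^ j)
  nonZero = ℕₚ.m*n≢0 _ _ {{ℕₚ.m^n≢0 p i {{prime⇒nonZero pp}}}} {{ℕₚ.m^n≢0 q j {{prime⇒nonZero pq}}}}
  regroup : ∀ p q x y → p ℕ.* x ℕ.* (q ℕ.* y) ≡ x ℕ.* y ℕ.* (p ℕ.* q)
  regroup = ℕ-RingSolver.solve-∀

-- The unit power sum of a product of two primes

∑-periodic : ∀ {m} p q (f : ℕ → ℤ) → (∀ r t → f (r ℕ.+ t ℕ.* p) ≈ f r [mod m ]) →
             ∑ (q ℕ.* p) f ≈ + q * ∑ p f [mod m ]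
∑-periodic {m} p q f periodic = begin
  ∑ (q ℕ.* p) f                            ≡⟨ ∑-blocks p q f ⟩
  ∑[ t < q ] ∑[ r < p ] f (r ℕ.+ t ℕ.* p)  ≈⟨ ∑-cong-mod q (λ t _ → ∑-cong-mod p (λ r _ → periodic r t)) ⟩
  ∑[ _ < q ] ∑ p f                         ≡⟨ ∑-const q (∑ p f) ⟩
  + q * ∑ p f                              ∎
  where open ≈-Reasoning m

∑-multiples : ∀ p q (f : ℕ → ℤ) → 0 < q →
              ∑[ k < p ℕ.* q ] ([ q ∣? k ]· f k) ≡ ∑[ t < p ] f (t ℕ.* q)
∑-multiples p q@(suc q′) f _ = trans (∑-blocks q p _) (∑-cong p (λ t _ → begin
  ∑[ i < q ] ([ q ∣? (i ℕ.+ t ℕ.* q) ]· f (i ℕ.+ t ℕ.* q))     ≡⟨ ∑-suc q′ _ ⟩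
  [ q ∣? (t ℕ.* q) ]· f (t ℕ.* q)
    + ∑[ i < q′ ] ([ q ∣? (suc i ℕ.+ t ℕ.* q) ]· f (suc i ℕ.+ t ℕ.* q))
    ≡⟨ cong₂ _+_ ([]·-yes (q ∣? (t ℕ.* q)) (n∣m*n t) _)
                 (∑-zero q′ _ (λ i i<q′ → []·-no (q ∣? (suc i ℕ.+ t ℕ.* q)) (q∤ {t} i i<q′) _)) ⟩
  f (t ℕ.* q) + 0ℤ                                             ≡⟨ ℤₚ.+-identityʳ _ ⟩
  f (t ℕ.* q)                                                  ∎))
  where
  open ≡-Reasoning
  q∤ : ∀ {t} i → i < q′ → ¬ q ∣ suc i ℕ.+ t ℕ.* q
  q∤ {t} i i<q′ q∣ = >⇒∤ (s≤s i<q′) (∣s+tM⇒∣s t ∣-refl q∣)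

∑-skip-zero : ∀ n (f : ℕ → ℤ) → 0 < n → ∑[ r < n ] ([ ¬? (n ∣? r) ]· f r) ≡ ∑ n f - f 0
∑-skip-zero n@(suc n′) f _ = begin
  ∑[ r < n ] ([ ¬? (n ∣? r) ]· f r)                                   ≡⟨ ∑-suc n′ _ ⟩
  [ ¬? (n ∣? 0) ]· f 0 + ∑[ i < n′ ] ([ ¬? (n ∣? suc i) ]· f (suc i))
    ≡⟨ cong₂ _+_ ([]·-no (¬? (n ∣? 0)) (λ n∤0 → n∤0 (n ∣0)) (f 0))
                 (∑-cong n′ (λ i i<n′ → []·-yes (¬? (n ∣? suc i)) (>⇒∤ (s≤s i<n′)) (f (suc i)))) ⟩
  0ℤ + ∑[ i < n′ ] f (suc i)          ≡⟨ shift (f 0) (∑[ i < n′ ] f (suc i)) ⟩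
  f 0 + ∑[ i < n′ ] f (suc i) - f 0   ≡⟨ cong (_- f 0) (∑-suc n′ f) ⟨
  ∑ n f - f 0                         ∎
  where
  open ≡-Reasoning
  shift : ∀ a b → 0ℤ + b ≡ a + b - a
  shift = solve-∀

coprime-pq-split : ∀ {p q} → Prime p → Prime q → ∀ k z →
  [ gcd k (p ℕ.* q) ≟ 1 ]· z ≡ [ ¬? (p ∣? k) ]· z - [ ¬? (p ∣? k) ]· ([ q ∣? k ]· z)
coprime-pq-split {p} {q} pp pq k z with p ∣? k | q ∣? k
... | yes p∣k | _ = []·-no (gcd k (p ℕ.* q) ≟ 1)
  (λ gcd≡1 → prime∣⇒¬coprime pp p∣k (m∣m*n q) (gcd≡1⇒coprime gcd≡1)) z
... | no p∤k | yes q∣k = trans ([]·-no (gcd k (p ℕ.* q) ≟ 1)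
  (λ gcd≡1 → prime∣⇒¬coprime pq q∣k (n∣m*n p) (gcd≡1⇒coprime gcd≡1)) z) (sym (ℤₚ.+-inverseʳ z))
... | no p∤k | no q∤k = trans ([]·-yes (gcd k (p ℕ.* q) ≟ 1)
  (coprime⇒gcd≡1 (coprime-* (∤⇒coprime pp p∤k) (∤⇒coprime pq q∤k))) z) (sym (ℤₚ.+-identityʳ z))

∑-coprime-excessTerm-≈1 : ∀ {p e} → Prime p → 0 < e → ¬ (p ∸ 1) ∣ e → ∀ q →
  ∑[ t < p ] ([ ¬? (p ∣? t) ]· excessTerm e (t ℕ.* q)) ≈ 1ℤ [mod + p ]
∑-coprime-excessTerm-≈1 {p} {e} pp 0<e p∸1∤e q = begin
  ∑[ t < p ] ([ ¬? (p ∣? t) ]· excessTerm e (t ℕ.* q))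
    ≡⟨ ∑-skip-zero p (λ t → excessTerm e (t ℕ.* q)) (prime>0 pp) ⟩
  ∑[ t < p ] excessTerm e (t ℕ.* q) - excessTerm e 0
    ≡⟨ cong₂ _-_ (∑-excessTerm-multiples p e q) (cong (_- 1ℤ) (0ℤ^-positive 0<e)) ⟩
  (+ q) ^ e * powerSum p e - + p * 1ℤ - (0ℤ - 1ℤ)
    ≈⟨ sub-cong (sub-cong (*-congˡ ((+ q) ^ e) (powerSum-≈0-∤ pp 0<e p∸1∤e)) (∣⇒*≈0 1ℤ ∣-refl))
                (≈-refl {a = 0ℤ - 1ℤ}) ⟩
  (+ q) ^ e * 0ℤ - 0ℤ - (0ℤ - 1ℤ)
    ≡⟨ cong (λ x → x - 0ℤ - (0ℤ - 1ℤ)) (ℤₚ.*-zeroʳ ((+ q) ^ e)) ⟩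
  1ℤ
    ∎
  where open ≈-Reasoning (+ p)

excess-pq≈q-1 : ∀ {p q e} → Prime p → Prime q → ¬ p ∣ q → 0 < e → ¬ (p ∸ 1) ∣ e →
              excess e (p ℕ.* q) ≈ + q - 1ℤ [mod + p ]
excess-pq≈q-1 {p} {q} {e} pp pq p∤q 0<e p∸1∤e = begin
  excess e (p ℕ.* q)            ≡⟨ ∑-cong (p ℕ.* q) (λ k _ → coprime-pq-split pp pq k (g k)) ⟩
  ∑[ k < p ℕ.* q ] (F k - G k)  ≡⟨ ∑-distrib-- (p ℕ.* q) ⟩
  ∑ (p ℕ.* q) F - ∑ (p ℕ.* q) G ≈⟨ sub-cong ∑F≈q ∑G≈1 ⟩
  + q * 1ℤ - 1ℤ                 ≡⟨ cong (_- 1ℤ) (ℤₚ.*-identityʳ (+ q)) ⟩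
  + q - 1ℤ                      ∎
  where
  open ≈-Reasoning (+ p)
  g = excessTerm e
  p∤? : ∀ k → Dec (¬ p ∣ k)
  p∤? k = ¬? (p ∣? k)
  F G : ℕ → ℤ
  F k = [ p∤? k ]· g k
  G k = [ p∤? k ]· ([ q ∣? k ]· g k)
  F-periodic : ∀ r t → F (r ℕ.+ t ℕ.* p) ≈ F r [mod + p ]
  F-periodic r t = ≈-trans
    (≈-reflexive ([]·-⇔ (p∤? (r ℕ.+ t ℕ.* p)) (p∤? r)
      (λ p∤r+tp p∣r → p∤r+tp (∣m∣n⇒∣m+n p∣r (n∣m*n t)))
      (λ p∤r p∣r+tp → p∤r (∣s+tM⇒∣s t ∣-refl p∣r+tp)) _))
    ([]·-cong-mod (p∤? r) (excessTerm-periodic e p r t))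
  ∑F≈q : ∑ (p ℕ.* q) F ≈ + q * 1ℤ [mod + p ]
  ∑F≈q = begin
    ∑ (p ℕ.* q) F
      ≡⟨ cong (λ n → ∑ n F) (ℕₚ.*-comm p q) ⟩
    ∑ (q ℕ.* p) F
      ≈⟨ ∑-periodic p q F F-periodic ⟩
    + q * ∑ p F
      ≡⟨ cong (+ q *_) (∑-cong p (λ r _ → cong (λ k → [ p∤? r ]· g k) (sym (ℕₚ.*-identityʳ r)))) ⟩
    + q * ∑[ r < p ] ([ p∤? r ]· g (r ℕ.* 1))
      ≈⟨ *-congˡ (+ q) (∑-coprime-excessTerm-≈1 pp 0<e p∸1∤e 1) ⟩
    + q * 1ℤ
      ∎
  ∑G≈1 : ∑ (p ℕ.* q) G ≈ 1ℤ [mod + p ]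
  ∑G≈1 = begin
    ∑ (p ℕ.* q) G
      ≡⟨ ∑-cong (p ℕ.* q) (λ k _ → []·-swap (p∤? k) (q ∣? k) (g k)) ⟩
    ∑[ k < p ℕ.* q ] ([ q ∣? k ]· F k)
      ≡⟨ ∑-multiples p q F (prime>0 pq) ⟩
    ∑[ t < p ] F (t ℕ.* q)
      ≡⟨ ∑-cong p (λ t _ → []·-⇔ (p∤? (t ℕ.* q)) (p∤? t)
           (λ p∤tq p∣t → p∤tq (∣m⇒∣m*n q p∣t))
           (λ p∤t p∣tq → [ p∤t , p∤q ]′ (euclidsLemma t q pp p∣tq))
           (g (t ℕ.* q))) ⟩
    ∑[ t < p ] ([ p∤? t ]· g (t ℕ.* q))
      ≈⟨ ∑-coprime-excessTerm-≈1 pp 0<e p∸1∤e q ⟩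
    1ℤ
      ∎

excessTerm-≈0 : ∀ {p e k} → Prime p → (p ∸ 1) ∣ e → ¬ p ∣ k → excessTerm e k ≈ 0ℤ [mod + p ]
excessTerm-≈0 pp p∸1∣e p∤k = Equivalence.to ≈⇔-≈0 (∣⇒^≈1 (fermat pp p∤k) p∸1∣e)

excess-pq-≈0 : ∀ {p q e} → Prime p → Prime q → ¬ p ∣ q → (p ∸ 1) ∣ e → (q ∸ 1) ∣ e →
               excess e (p ℕ.* q) ≈ 0ℤ [mod + (p ℕ.* q) ]
excess-pq-≈0 {p} {q} {e} pp pq p∤q p∸1∣e q∸1∣e = ∑-≈0 (p ℕ.* q) (λ k _ → unit-term k)
  where
  unit-term : ∀ k → [ gcd k (p ℕ.* q) ≟ 1 ]· excessTerm e k ≈ 0ℤ [mod + (p ℕ.* q) ]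
  unit-term k with gcd k (p ℕ.* q) ≟ 1
  ... | no _ = ≈-refl
  ... | yes gcd≡1 = coprime⇒≈0 (Coprime-sym (∤⇒coprime pp p∤q))
    (excessTerm-≈0 pp p∸1∣e (λ p∣k → prime∣⇒¬coprime pp p∣k (m∣m*n q) k⊥pq))
    (excessTerm-≈0 pq q∸1∣e (λ q∣k → prime∣⇒¬coprime pq q∣k (n∣m*n p) k⊥pq))
    where k⊥pq = gcd≡1⇒coprime gcd≡1

excess-≈0⇒∣∸1 : ∀ {p q e} → Prime p → Prime q → ¬ p ∣ q → 0 < e → ¬ (p ∸ 1) ∣ e →
                excess e (p ℕ.* q) ≈ 0ℤ [mod + (p ℕ.* q) ] → p ∣ q ∸ 1
excess-≈0⇒∣∸1 {p} {q} pp pq p∤q 0<e p∸1∤e E≈0 = Equivalence.to (≈1⇔∣∸1 (prime>0 pq))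
  (Equivalence.from ≈⇔-≈0 (≈-trans (≈-sym (excess-pq≈q-1 pp pq p∤q 0<e p∸1∤e))
                                   (≈-divisor (ℤ∣.∣ᵤ⇒∣ {+ p} {+ (p ℕ.* q)} (m∣m*n q)) E≈0)))

excess-pq-≈0⇔ : ∀ {p q e} → Prime p → Prime q → p < q → ¬ p ∣ q ∸ 1 → 0 < e →
                excess e (p ℕ.* q) ≈ 0ℤ [mod + (p ℕ.* q) ] ⇔ ((p ∸ 1) ∣ e × (q ∸ 1) ∣ e)
excess-pq-≈0⇔ {p} {q} {e} pp pq p<q p∤q∸1 0<e =
  mk⇔ necessary (λ (p∸1∣e , q∸1∣e) → excess-pq-≈0 pp pq p∤q p∸1∣e q∸1∣e)
  where
  p∤q : ¬ p ∣ q
  p∤q p∣q with prime⇒irreducible pq p∣q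
  ... | inj₁ p≡1 = ℕ.nonTrivial⇒≢1 {{prime⇒nonTrivial pp}} p≡1
  ... | inj₂ p≡q = ℕₚ.<-irrefl p≡q p<q
  q∤p : ¬ q ∣ p
  q∤p = >⇒∤ {{prime⇒nonZero pp}} p<q
  q∤p∸1 : ¬ q ∣ p ∸ 1
  q∤p∸1 = >⇒∤ {{ℕ.>-nonZero (ℕₚ.m<n⇒0<n∸m (ℕ.nonTrivial⇒n>1 p {{prime⇒nonTrivial pp}}))}}
               (ℕₚ.≤-<-trans (ℕₚ.m∸n≤m p 1) p<q)
  necessary : excess e (p ℕ.* q) ≈ 0ℤ [mod + (p ℕ.* q) ] → (p ∸ 1) ∣ e × (q ∸ 1) ∣ e
  necessary E≈0 =
    decidable-stable ((p ∸ 1) ∣? e) (λ p∸1∤e → p∤q∸1 (excess-≈0⇒∣∸1 pp pq p∤q 0<e p∸1∤e E≈0)) ,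
    decidable-stable ((q ∸ 1) ∣? e) (λ q∸1∤e → q∤p∸1 (excess-≈0⇒∣∸1 pq pp q∤p 0<e q∸1∤e
      (subst (λ N → excess e N ≈ 0ℤ [mod + N ]) (ℕₚ.*-comm p q) E≈0)))

≡[mod]⇔≈ : ∀ {a b m} → a ≡ b [mod m ] ⇔ + a ≈ + b [mod + m ]
≡[mod]⇔≈ = mk⇔ (λ m∣a-b → mod∣ (ℤ∣.∣ᵤ⇒∣ m∣a-b)) (λ (mod∣ m∣a-b) → ℤ∣.∣⇒∣ᵤ m∣a-b)

^≡1[mod]⇔^≈1 : ∀ {x m} w → (x ℕ.^ w) ≡ 1 [mod m ] ⇔ (+ x) ^ w ≈ 1ℤ [mod + m ]
^≡1[mod]⇔^≈1 {x} {m} w =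
  subst (λ y → (x ℕ.^ w) ≡ 1 [mod m ] ⇔ y ≈ 1ℤ [mod + m ]) (pos-^ x w) ≡[mod]⇔≈

IsLeastPos-⇔ : ∀ {P Q : ℕ → Set} {v} → (∀ w → P w ⇔ Q w) → IsLeastPos P v → IsLeastPos Q v
IsLeastPos-⇔ P⇔Q (0<v , Pv , least) =
  0<v , Equivalence.to (P⇔Q _) Pv , λ w 0<w Qw → least w 0<w (Equivalence.from (P⇔Q w) Qw)

order-∣ : ∀ {m x v} → IsLeastPos (λ w → x ^ w ≈ 1ℤ [mod m ]) v → ∀ {b} → x ^ b ≈ 1ℤ [mod m ] → v ∣ b
order-∣ {m} {x} {v} (0<v , x^v≈1 , least) {b} x^b≈1 = m%n≡0⇒n∣m b v (remainder≡0 (b % v) refl)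
  where
  instance _ = ℕ.>-nonZero 0<v
  x^[b%v]≈1 : x ^ (b % v) ≈ 1ℤ [mod m ]
  x^[b%v]≈1 = ≈-trans (≈-sym (^-reduce x^v≈1 (b % v) (b / v)))
                      (subst (λ k → x ^ k ≈ 1ℤ [mod m ]) (m≡m%n+[m/n]*n b v) x^b≈1)
  remainder≡0 : ∀ r → b % v ≡ r → b % v ≡ 0
  remainder≡0 zero    b%v≡0   = b%v≡0
  remainder≡0 (suc r) b%v≡1+r = ⊥-elim (ℕₚ.<⇒≱ (subst (_< v) b%v≡1+r (m%n<n b v))
    (least (suc r) (s≤s z≤n) (subst (λ k → x ^ k ≈ 1ℤ [mod m ]) b%v≡1+r x^[b%v]≈1)))

order-⇔ : ∀ {x m v} → IsLeastPos (λ w → (x ℕ.^ w) ≡ 1 [mod m ]) v →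
          ∀ b → (+ x) ^ b ≈ 1ℤ [mod + m ] ⇔ v ∣ b
order-⇔ least b = mk⇔ (order-∣ order) (∣⇒^≈1 (proj₁ (proj₂ order)))
  where order = IsLeastPos-⇔ ^≡1[mod]⇔^≈1 least

∣∸1⇔^≈1 : ∀ {m x y N} a b → 0 < N → + N ≡ (+ x) ^ a * (+ y) ^ b → + x ≈ 1ℤ [mod + m ] →
          m ∣ N ∸ 1 ⇔ (+ y) ^ b ≈ 1ℤ [mod + m ]
∣∸1⇔^≈1 {m} {x} {y} {N} a b 0<N N≡x^a*y^b x≈1 = mk⇔
  (λ m∣N∸1 → ≈-trans (≈-sym N≈y^b) (Equivalence.from (≈1⇔∣∸1 0<N) m∣N∸1))
  (λ y^b≈1 → Equivalence.to (≈1⇔∣∸1 0<N) (≈-trans N≈y^b y^b≈1))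
  where
  open ≈-Reasoning (+ m)
  N≈y^b : + N ≈ (+ y) ^ b [mod + m ]
  N≈y^b = begin
    + N                    ≡⟨ N≡x^a*y^b ⟩
    (+ x) ^ a * (+ y) ^ b  ≈⟨ *-cong (^-≈1 a x≈1) ≈-refl ⟩
    1ℤ * (+ y) ^ b         ≡⟨ ℤₚ.*-identityˡ _ ⟩
    (+ y) ^ b              ∎

sum-filter-range1 : ∀ {P : ℕ → Set} (P? : Decidable P) (f : ℕ → ℕ) m →
  + sum (map f (filter P? (range1 m))) ≡ ∑[ i < m ] ([ P? (suc i) ]· (+ f (suc i)))
sum-filter-range1 P? f zero    = refl
sum-filter-range1 P? f (suc m) = begin
  + sum (map f (filter P? (range1 m ++ suc m ∷ [])))
    ≡⟨ cong (λ xs → + sum (map f xs)) (filter-++ P? (range1 m) (suc m ∷ [])) ⟩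
  + sum (map f (filter P? (range1 m) ++ filter P? (suc m ∷ [])))
    ≡⟨ cong (λ xs → + sum xs) (map-++ f (filter P? (range1 m)) _) ⟩
  + sum (map f (filter P? (range1 m)) ++ map f (filter P? (suc m ∷ [])))
    ≡⟨ cong +_ (sum-++ (map f (filter P? (range1 m))) _) ⟩
  + (sum (map f (filter P? (range1 m))) ℕ.+ sum (map f (filter P? (suc m ∷ []))))
    ≡⟨ ℤₚ.pos-+ (sum (map f (filter P? (range1 m)))) _ ⟩
  + sum (map f (filter P? (range1 m))) + + sum (map f (filter P? (suc m ∷ [])))
    ≡⟨ cong₂ _+_ (sum-filter-range1 P? f m) (singleton (suc m)) ⟩
  ∑[ i < m ] ([ P? (suc i) ]· (+ f (suc i))) + [ P? (suc m) ]· (+ f (suc m))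
    ∎
  where
  open ≡-Reasoning
  singleton : ∀ k → + sum (map f (filter P? (k ∷ []))) ≡ [ P? k ]· (+ f k)
  singleton k with P? k
  ... | yes _ = cong +_ (ℕₚ.+-identityʳ (f k))
  ... | no _  = refl

length≡sum-ones : ∀ (xs : List ℕ) → length xs ≡ sum (map (λ _ → 1) xs)
length≡sum-ones []       = refl
length≡sum-ones (x ∷ xs) = cong suc (length≡sum-ones xs)

excess≡sum-φ : ∀ {n} → 1 < n →
  excess (n ∸ 1) n ≡ + sum (map (λ k → k ℕ.^ (n ∸ 1)) (coprimeUnits n)) - + φ n
excess≡sum-φ {n@(suc n′)} 1<n = begin
  excess e n
    ≡⟨ ∑-suc n′ _ ⟩
  [ unit? 0 ]· excessTerm e 0 + ∑[ i < n′ ] ([ unit? (suc i) ]· excessTerm e (suc i))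
    ≡⟨ cong₂ _+_ ([]·-no (unit? 0) (multiple-not-unit 1<n (n ∣0)) _)
                 (∑-cong n′ (λ i _ → []·-- (unit? (suc i)) _ 1ℤ)) ⟩
  0ℤ + ∑[ i < n′ ] ([ unit? (suc i) ]· ((+ suc i) ^ e) - [ unit? (suc i) ]· 1ℤ)
    ≡⟨ trans (ℤₚ.+-identityˡ _) (∑-distrib-- n′) ⟩
  ∑[ i < n′ ] ([ unit? (suc i) ]· ((+ suc i) ^ e)) - ∑[ i < n′ ] ([ unit? (suc i) ]· 1ℤ)
    ≡⟨ cong₂ _-_ powers units ⟩
  + sum (map (λ k → k ℕ.^ e) (coprimeUnits n)) - + φ n
    ∎
  where
  open ≡-Reasoning
  e = n ∸ 1
  unit? : ∀ k → Dec (gcd k n ≡ 1)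
  unit? k = gcd k n ≟ 1
  powers : ∑[ i < n′ ] ([ unit? (suc i) ]· ((+ suc i) ^ e))
           ≡ + sum (map (λ k → k ℕ.^ e) (coprimeUnits n))
  powers = sym (trans (sum-filter-range1 unit? (λ k → k ℕ.^ e) n′)
                      (∑-cong n′ (λ i _ → cong ([ unit? (suc i) ]·_) (pos-^ (suc i) e))))
  units : ∑[ i < n′ ] ([ unit? (suc i) ]· 1ℤ) ≡ + φ n
  units = sym (begin
    + φ n
      ≡⟨ cong +_ (length≡sum-ones (filter unit? (range1 n))) ⟩
    + sum (map (λ _ → 1) (filter unit? (range1 n)))
      ≡⟨ sum-filter-range1 unit? (λ _ → 1) n ⟩
    ∑[ i < n′ ] ([ unit? (suc i) ]· 1ℤ) + [ unit? n ]· 1ℤ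
      ≡⟨ cong (λ z → ∑[ i < n′ ] ([ unit? (suc i) ]· 1ℤ) + z)
              ([]·-no (unit? n) (multiple-not-unit 1<n ∣-refl) 1ℤ) ⟩
    ∑[ i < n′ ] ([ unit? (suc i) ]· 1ℤ) + 0ℤ
      ≡⟨ ℤₚ.+-identityʳ _ ⟩
    ∑[ i < n′ ] ([ unit? (suc i) ]· 1ℤ)
      ∎)

weakCarmichael-congruence⇔ : ∀ {n} → 1 < n →
  (sum (map (λ k → k ℕ.^ (n ∸ 1)) (coprimeUnits n)) ≡ φ n [mod n ])
    ⇔ excess (n ∸ 1) n ≈ 0ℤ [mod + n ]
weakCarmichael-congruence⇔ {n} 1<n =
  subst (λ E → (S ≡ φ n [mod n ]) ⇔ E ≈ 0ℤ [mod + n ]) (sym (excess≡sum-φ 1<n))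
        (⇔-trans (≡[mod]⇔≈ {S} {φ n}) ≈⇔-≈0)
  where S = sum (map (λ k → k ℕ.^ (n ∸ 1)) (coprimeUnits n))


proposition2p36 : (p q : ℕ) → Prime p → Prime q → ¬ (2 ∣ p) → ¬ (2 ∣ q) → p < q →
    ¬ (p ∣ (q ∸ 1)) →
    (u v : ℕ) → IsLeastPos (λ w → (p ℕ.^ w) ≡ 1 [mod (q ∸ 1) ]) u →
    IsLeastPos (λ w → (q ℕ.^ w) ≡ 1 [mod (p ∸ 1) ]) v →
    (a b : ℕ) → 0 < a → 0 < b →
    (WeakCarmichael ((p ℕ.^ a) ℕ.* (q ℕ.^ b)) ⇔ ((u ∣ a) × (v ∣ b)))
proposition2p36 p q pp pq 2∤p 2∤q p<q p∤q∸1 u v U V a@(suc i) b@(suc j) _ _ = begin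
  WeakCarmichael n
    ≈⟨ mk⇔ proj₂ (n-composite ,_) ⟩
  (sum (map (λ k → k ℕ.^ (n ∸ 1)) (coprimeUnits n)) ≡ φ n [mod n ])
    ≈⟨ weakCarmichael-congruence⇔ 1<n ⟩
  excess (n ∸ 1) n ≈ 0ℤ [mod + n ]
    ≈⟨ excess-≈0⇔excess-pq-≈0 (n ∸ 1) pp pq 2∤p 2∤q i j ⟩
  excess (n ∸ 1) (p ℕ.* q) ≈ 0ℤ [mod + (p ℕ.* q) ]
    ≈⟨ excess-pq-≈0⇔ pp pq p<q p∤q∸1 (ℕₚ.m<n⇒0<n∸m 1<n) ⟩
  ((p ∸ 1) ∣ n ∸ 1 × (q ∸ 1) ∣ n ∸ 1)
    ≈⟨ ⇔-trans (∣∸1⇔^≈1 a b 0<n n≡p^a*q^b (self≈1 pp)) (order-⇔ V b)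
   ×-⇔ ⇔-trans (∣∸1⇔^≈1 b a 0<n n≡q^b*p^a (self≈1 pq)) (order-⇔ U a) ⟩
  (v ∣ b × u ∣ a)
    ≈⟨ mk⇔ swap swap ⟩
  (u ∣ a × v ∣ b)
    ∎
  where
  open import Relation.Binary.Reasoning.Setoid (⇔-setoid 0ℓ)
  n = p ℕ.^ a ℕ.* q ℕ.^ b
  n-composite : Composite n
  n-composite = ^*^-composite pp pq i j
  1<n : 1 < n
  1<n = ℕ.nonTrivial⇒n>1 n {{composite⇒nonTrivial n-composite}}
  0<n : 0 < n
  0<n = ℕₚ.<-trans (s≤s z≤n) 1<n
  n≡p^a*q^b : + n ≡ (+ p) ^ a * (+ q) ^ b
  n≡p^a*q^b = pos-^*^ p q a b
  n≡q^b*p^a : + n ≡ (+ q) ^ b * (+ p) ^ a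
  n≡q^b*p^a = trans n≡p^a*q^b (ℤₚ.*-comm ((+ p) ^ a) ((+ q) ^ b))
  self≈1 : ∀ {r} → Prime r → + r ≈ 1ℤ [mod + (r ∸ 1) ]
  self≈1 pr = Equivalence.from (≈1⇔∣∸1 (prime>0 pr)) ∣-refl
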